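{- If $G$ is the cycle $C_\ell$, then every generalized inflation graph $H$ of $G$ satisfies $\sigma_T(H)=2\ell-1$.
   Context: All graphs are finite and simple. A generalized inflation of a graph $G$ is a graph $H$ obtained by replacing each vertex $v$ of $G$ by a clique $Q_v$ of size at least $d_G(v)$, and each edge $uv$ of $G$ by an edge between a vertex of $Q_u$ and a vertex of $Q_v$, in such a way that the edges of $H$ arising from edges of $G$ form a matching of $H$. A tree $t$-spanner of a connected graph $G$ is a spanning tree $T$ with $d_T(u,v)\le t$ for every edge $uv$ of $G$; the stretch index $\sigma_T(G)$ is the smallest $t$ for which $G$ has a tree $t$-spanner. -}

module Defs where

open import Data.Nat using (ℕ; zero; suc; _≤_; _%_; NonZero)
open import Data.Nat.Properties using () renaming (_≟_ to _≟ℕ_)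
open import Data.Fin using (Fin; toℕ)
open import Data.Fin.Properties using (_≟_)
open import Data.List using (List; []; _∷_; _++_; length; filter; allFin)
open import Data.List.Relation.Unary.Unique.Propositional using (Unique)
open import Data.Product using (Σ; ∃; ∃-syntax; _×_; _,_)
open import Data.Sum using (_⊎_)
open import Data.Unit using (⊤)
open import Relation.Binary.PropositionalEquality using (_≡_; _≢_)
open import Relation.Nullary using (Dec; ¬_)
open import Relation.Nullary.Decidable using (_⊎-dec_)
open import Level using (0ℓ)

record Graph : Set₁ where
  field
    n    : ℕ
    Adj  : Fin n → Fin n → Set
    adj? : (u v : Fin n) → Dec (Adj u v)
open Graph public

record IsSimple (G : Graph) : Set where
  field
    sym     : ∀ {u v} → Adj G u v → Adj G v u
    irrefl  : ∀ {u} → ¬ Adj G u u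
open IsSimple public

deg : (G : Graph) → Fin (n G) → ℕ
deg G v = length (filter (adj? G v) (allFin (n G)))

-- The cycle C_ℓ on vertices 0,…,ℓ-1 (i ~ i+1 mod ℓ); a cycle for ℓ ≥ 3.

CycleAdj : (ℓ : ℕ) → .{{NonZero ℓ}} → Fin ℓ → Fin ℓ → Set
CycleAdj ℓ i j = (suc (toℕ i) % ℓ ≡ toℕ j) ⊎ (suc (toℕ j) % ℓ ≡ toℕ i)

Cycle : (ℓ : ℕ) → .{{NonZero ℓ}} → Graph
Cycle ℓ = record
  { n    = ℓ
  ; Adj  = CycleAdj ℓ
  ; adj? = λ i j → (suc (toℕ i) % ℓ ≟ℕ toℕ j) ⊎-dec (suc (toℕ j) % ℓ ≟ℕ toℕ i)
  }

-- Generalized inflation H of G, witnessed by the map φ sending each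
-- vertex of H to the vertex v of G whose clique Q_v contains it.

record IsGeneralizedInflation (G H : Graph) : Set where
  field
    φ : Fin (n H) → Fin (n G)
    clique : ∀ x y → x ≢ y → φ x ≡ φ y → Adj H x y
    size : ∀ v → deg G v ≤ length (filter (λ x → φ x ≟ v) (allFin (n H)))
    inter-edge : ∀ x y → Adj H x y → φ x ≢ φ y → Adj G (φ x) (φ y)
    edge-exists : ∀ u v → Adj G u v → ∃[ x ] ∃[ y ] (φ x ≡ u × φ y ≡ v × Adj H x y)
    edge-unique : ∀ x y x′ y′ → Adj H x y → Adj H x′ y′ → φ x ≢ φ y →
                  φ x ≡ φ x′ → φ y ≡ φ y′ → (x ≡ x′ × y ≡ y′)
    -- the edges arising from edges of G form a matching of H
    matching : ∀ x y y′ → Adj H x y → Adj H x y′ → φ x ≢ φ y → φ x ≢ φ y′ → y ≡ y′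

module _ {m : ℕ} (R : Fin m → Fin m → Set) where

  data Walk : Fin m → Fin m → ℕ → Set where
    []  : ∀ {x} → Walk x x 0
    _∷_ : ∀ {x y z k} → R x y → Walk y z k → Walk x z (suc k)

  Chain : List (Fin m) → Set
  Chain []           = ⊤
  Chain (x ∷ [])     = ⊤
  Chain (x ∷ y ∷ xs) = R x y × Chain (y ∷ xs)

  HasCycle : Set
  HasCycle = ∃[ x ] ∃[ ys ] (2 ≤ length ys × Unique (x ∷ ys) × Chain (x ∷ ys ++ x ∷ []))

  Connected : Set
  Connected = ∀ x y → ∃[ k ] Walk x y k

  DistLe : Fin m → Fin m → ℕ → Set
  DistLe x y t = ∃[ k ] (k ≤ t × Walk x y k)

record IsSpanningTree (H : Graph) (T : Fin (n H) → Fin (n H) → Set) : Set where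
  field
    subgraph  : ∀ {x y} → T x y → Adj H x y
    symmetric : ∀ {x y} → T x y → T y x
    connected : Connected T
    acyclic   : ¬ HasCycle T

IsTreeSpanner : (H : Graph) → (Fin (n H) → Fin (n H) → Set) → ℕ → Set
IsTreeSpanner H T t = IsSpanningTree H T × (∀ u v → Adj H u v → DistLe T u v t)

StretchIndexIs : Graph → ℕ → Set₁
StretchIndexIs H s =
  (∃[ T ] IsTreeSpanner H T s) ×
  (∀ t (T : Fin (n H) → Fin (n H) → Set) → IsTreeSpanner H T t → s ≤ t)

{-# OPTIONS --safe #-}
module Submission where

-- Let src i ∈ Q_i and hub (i+1) ∈ Q_(i+1) be the ends of the edge of H replacing the edge
-- i (i+1) of C_ℓ; the matching condition and ℓ ≥ 3 force src j ≠ hub j.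
--
-- Upper bound: make every clique a star centred at its hub and attach hub (j+1) to src j for
-- j < ℓ-1.  Edges inside a clique are then stretched to at most 2, and the one remaining
-- edge src (ℓ-1) hub 0 to the length 2ℓ-1 of the tree path src (ℓ-1), hub (ℓ-1), …, src 0, hub 0.
--
-- Lower bound: give hub j the level 2j and the other vertices of Q_j the level 2j+1, read
-- modulo 2ℓ.  Along every edge the level changes by at most one, so a walk of length d < 2ℓ-1
-- lifts to the integers (counting the crossings from Q_(ℓ-1) to Q_0) with displacement at most d.
-- Hence the tree path spanning an edge from level r to level r+1 crosses Q_(ℓ-1) → Q_0 as often,
-- in the net, as the edge itself.  Doing this for every edge of the cycle
-- hub 0, src 0, hub 1, src 1, …, src (ℓ-1), hub 0 gives a closed walk in the tree with net
-- crossing number one, but in a forest every closed walk crosses each edge equally often in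
-- both directions.

open import Defs hiding (sym)
open import Data.Nat using (ℕ; zero; suc; _+_; _*_; _∸_; _%_; _⊔_; ∣_-_∣; _≤_; _<_; z≤n; s≤s; NonZero)
open import Data.Nat.Properties
  using (≤-refl; ≤-reflexive; ≤-trans; ≤-pred; <-irrefl; <-trans; <⇒≱; ≮⇒≥; n≮0; n<1+n; m<n⇒m<1+n;
         suc-injective; 1+n≢0; 1+n≢n; +-assoc; +-comm; +-suc; +-identityʳ; +-cancelʳ-≡;
         +-mono-≤; +-monoˡ-≤; +-monoʳ-<; m≤n+m; *-suc; *-zeroʳ; *-identityʳ; *-distribˡ-+; m≤m*n;
         ⊔-lub; ∣n-n∣≡0; ∣m-n∣≡0⇒m≡n; ∣m+n-m+o∣≡∣n-o∣; ∣-∣-comm; ∣-∣-triangle; ∣m-n∣≤m⊔n;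
         *-distribˡ-∣-∣; module ≤-Reasoning)
open import Data.Nat.DivMod using (m%n<n; n%n≡0; m<n⇒m%n≡m)
open import Data.Nat.Tactic.RingSolver using (solve-∀)
open import Data.Fin using (Fin; zero; suc; toℕ; fromℕ; fromℕ<; inject₁)
open import Data.Fin.Properties using (_≟_; toℕ-fromℕ<; toℕ-fromℕ; toℕ-inject₁; toℕ-injective; toℕ<n)
import Data.Fin.Properties as Fin
open import Data.Fin.Induction using (<-weakInduction)
open import Data.Fin.Relation.Unary.Top using (view; ‵fromℕ; ‵inject₁)
open import Data.List using (List; []; _∷_; _++_; length)
open import Data.List.Properties using (length-++)
open import Data.List.Relation.Unary.All using (All; []; _∷_) renaming (lookup to All-lookup)
open import Data.List.Relation.Unary.All.Properties.Core using (¬Any⇒All¬)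
open import Data.List.Relation.Unary.AllPairs using ([]; _∷_)
open import Data.List.Relation.Unary.Any using (here; there)
open import Data.List.Relation.Unary.Unique.Propositional using (Unique)
open import Data.List.Membership.Propositional using (_∈_)
open import Data.List.Membership.Propositional.Properties using (∈-∃++)
import Data.List.Membership.DecPropositional as DecMembership
open import Data.Product using (∃-syntax; _×_; _,_; proj₁; proj₂)
open import Data.Sum using (_⊎_; inj₁; inj₂; swap)
open import Data.Unit using (⊤; tt)
open import Data.Empty using (⊥; ⊥-elim)
open import Function using (flip)
open import Relation.Binary.PropositionalEquality
  using (_≡_; _≢_; refl; sym; trans; cong; cong₂; subst; module ≡-Reasoning)
open import Relation.Nullary using (¬_; yes; no)

-- Paths and flows

module _ {m : ℕ} where

  open DecMembership (_≟_ {m}) using (_∈?_)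

  data Path (R : Fin m → Fin m → Set) : Fin m → List (Fin m) → Fin m → Set where
    []  : ∀ {x} → Path R x [] x
    _∷_ : ∀ {x y L z} → R x y → Path R y L z → Path R x (y ∷ L) z

  target : Fin m → List (Fin m) → Fin m
  target x []      = x
  target x (y ∷ L) = target y L

  flow : (Fin m → Fin m → ℕ) → Fin m → List (Fin m) → ℕ
  flow c x []      = 0
  flow c x (y ∷ L) = c x y + flow c y L

  flow-++ : ∀ c x A B → flow c x (A ++ B) ≡ flow c x A + flow c (target x A) B
  flow-++ c x []      B = refl
  flow-++ c x (y ∷ A) B = trans (cong (c x y +_) (flow-++ c y A B)) (sym (+-assoc (c x y) _ _))

  target-∷ʳ : ∀ x L y → target x (L ++ y ∷ []) ≡ y
  target-∷ʳ x []      y = refl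
  target-∷ʳ x (z ∷ L) y = target-∷ʳ z L y

  module _ {R : Fin m → Fin m → Set} where

    Path-target : ∀ {x L y} → Path R x L y → target x L ≡ y
    Path-target []      = refl
    Path-target (_ ∷ p) = Path-target p

    Path-++ : ∀ {x A y B z} → Path R x A y → Path R y B z → Path R x (A ++ B) z
    Path-++ []      q = q
    Path-++ (e ∷ p) q = e ∷ Path-++ p q

    Path-split : ∀ {x B z} A → Path R x (A ++ B) z →
                 Path R x A (target x A) × Path R (target x A) B z
    Path-split []      p       = [] , p
    Path-split (y ∷ A) (e ∷ p) with Path-split A p
    ... | p₁ , p₂ = e ∷ p₁ , p₂

    flow-Path-++ : ∀ c {x A y} B → Path R x A y → flow c x (A ++ B) ≡ flow c x A + flow c y B
    flow-Path-++ c {x} {A} B p = trans (flow-++ c x A B) (cong (λ z → flow c x A + flow c z B) (Path-target p))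

    Walk⇒Path : ∀ {x y k} → Walk R x y k → ∃[ L ] (length L ≡ k × Path R x L y)
    Walk⇒Path []      = [] , refl , []
    Walk⇒Path (e ∷ w) with Walk⇒Path w
    ... | L , refl , p = _ ∷ L , refl , e ∷ p

    Path⇒Chain : ∀ {x L z} → Path R x L z → Chain R (x ∷ L)
    Path⇒Chain []           = tt
    Path⇒Chain (e ∷ [])     = e , tt
    Path⇒Chain (e ∷ e′ ∷ p) = e , Path⇒Chain (e′ ∷ p)

  Winds : (Fin m → Fin m → Set) → (Fin m → Fin m → ℕ) → Fin m → Fin m → ℕ → Set
  Winds R c u v w = ∃[ L ] (Path R u L v × flow c u L ≡ w + flow (flip c) u L)

  Winds-++ : ∀ {R c u v z w w′} → Winds R c u v w → Winds R c v z w′ → Winds R c u z (w + w′)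
  Winds-++ {c = c} {u} {w = w} {w′} (A , p , fA) (B , q , fB) = A ++ B , Path-++ p q , (begin
    flow c u (A ++ B)                              ≡⟨ flow-Path-++ c B p ⟩
    flow c u A + flow c _ B                        ≡⟨ cong₂ _+_ fA fB ⟩
    (w + flow (flip c) u A) + (w′ + flow (flip c) _ B) ≡⟨ regroup w w′ (flow (flip c) u A) _ ⟩
    (w + w′) + (flow (flip c) u A + flow (flip c) _ B) ≡⟨ cong ((w + w′) +_) (flow-Path-++ (flip c) B p) ⟨
    (w + w′) + flow (flip c) u (A ++ B)            ∎)
    where
      open ≡-Reasoning
      regroup : ∀ a b c d → (a + c) + (b + d) ≡ (a + b) + (c + d)
      regroup = solve-∀

  Repeats : List (Fin m) → Set
  Repeats L = ∃[ A ] ∃[ u ] ∃[ B ] ∃[ C ] L ≡ A ++ u ∷ B ++ u ∷ C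

  unique-or-repeats : ∀ L → Unique L ⊎ Repeats L
  unique-or-repeats []       = inj₁ []
  unique-or-repeats (x ∷ xs) with x ∈? xs
  ... | yes x∈xs with B , C , refl ← ∈-∃++ x∈xs = inj₂ ([] , x , B , C , refl)
  ... | no x∉xs with unique-or-repeats xs
  ...   | inj₁ u                        = inj₁ (¬Any⇒All¬ xs x∉xs ∷ u)
  ...   | inj₂ (A , u , B , C , refl)   = inj₂ (x ∷ A , u , B , C , refl)

  flow-excise : ∀ c x A u B C →
    flow c x (A ++ u ∷ B ++ u ∷ C) ≡ flow c u (B ++ u ∷ []) + flow c x (A ++ u ∷ C)
  flow-excise c x A u B C
    rewrite flow-++ c x A (u ∷ B ++ u ∷ C) | flow-++ c u B (u ∷ C)
          | flow-++ c u B (u ∷ []) | flow-++ c x A (u ∷ C)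
    = rearrange (flow c x A) (c (target x A) u) (flow c u B) (c (target u B) u) (flow c u C)
    where
      rearrange : ∀ a b c d e → a + (b + (c + (d + e))) ≡ (c + (d + 0)) + (a + (b + e))
      rearrange = solve-∀

  excise-shorter : ∀ (A : List (Fin m)) u B C →
    length (B ++ u ∷ []) < length (A ++ u ∷ B ++ u ∷ C) ×
    length (A ++ u ∷ C) < length (A ++ u ∷ B ++ u ∷ C)
  excise-shorter A u B C
    rewrite length-++ A {u ∷ B ++ u ∷ C} | length-++ B {u ∷ C}
          | length-++ B {u ∷ []} | length-++ A {u ∷ C}
    = loop-shorter , rest-shorter
    where
      open ≤-Reasoning
      loop-shorter : length B + 1 < length A + suc (length B + suc (length C))
      loop-shorter = begin-strict
        length B + 1                         <⟨ +-monoʳ-< (length B) (s≤s (s≤s z≤n)) ⟩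
        length B + suc (suc (length C))      ≡⟨ +-suc (length B) _ ⟩
        suc (length B + suc (length C))      ≤⟨ m≤n+m _ (length A) ⟩
        length A + suc (length B + suc (length C)) ∎
      rest-shorter : length A + suc (length C) < length A + suc (length B + suc (length C))
      rest-shorter = +-monoʳ-< (length A) (s≤s (m≤n+m _ (length B)))

  module _ {R : Fin m → Fin m → Set} (acyclic : ¬ HasCycle R) (c : Fin m → Fin m → ℕ) where

    closed-path-balanced : ∀ {x L} → Path R x L x → flow c x L ≡ flow (flip c) x L
    closed-path-balanced {L = L} = balanced (length L) ≤-refl
      where
        unique-balanced : ∀ {x L} → Unique L → Path R x L x → flow c x L ≡ flow (flip c) x L
        unique-balanced _ []               = refl
        unique-balanced _ (_ ∷ [])         = refl
        unique-balanced {x} {y ∷ _} _ (_ ∷ _ ∷ []) = two-cycle (c x y) (c y x)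
          where
            two-cycle : ∀ a b → a + (b + 0) ≡ b + (a + 0)
            two-cycle = solve-∀
        unique-balanced uq (e ∷ q@(_ ∷ _ ∷ _)) =
          ⊥-elim (acyclic (_ , _ , s≤s (s≤s z≤n) , uq , Path⇒Chain (Path-++ q (e ∷ []))))

        balanced : ∀ n {x L} → length L ≤ n → Path R x L x → flow c x L ≡ flow (flip c) x L
        balanced n {L = L} _ p with unique-or-repeats L
        ... | inj₁ uq = unique-balanced uq p
        balanced zero L≤0 p | inj₂ (A , u , B , C , refl) =
          ⊥-elim (n≮0 (≤-trans (proj₂ (excise-shorter A u B C)) L≤0))
        balanced (suc n) {x} L≤1+n p | inj₂ (A , u , B , C , refl)
          with p₁ , (e₁ ∷ q) ← Path-split A p
          with q₁ , (e₂ ∷ q₂) ← Path-split B q = begin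
            flow c x (A ++ u ∷ B ++ u ∷ C)
              ≡⟨ flow-excise c x A u B C ⟩
            flow c u (B ++ u ∷ []) + flow c x (A ++ u ∷ C)
              ≡⟨ cong₂ _+_ (balanced n (shorter (proj₁ (excise-shorter A u B C))) loop)
                           (balanced n (shorter (proj₂ (excise-shorter A u B C))) rest) ⟩
            flow (flip c) u (B ++ u ∷ []) + flow (flip c) x (A ++ u ∷ C)
              ≡⟨ flow-excise (flip c) x A u B C ⟨
            flow (flip c) x (A ++ u ∷ B ++ u ∷ C) ∎
          where
            open ≡-Reasoning
            loop : Path R u (B ++ u ∷ []) u
            loop = Path-++ q₁ (e₂ ∷ [])
            rest : Path R x (A ++ u ∷ C) x
            rest = Path-++ p₁ (e₁ ∷ q₂)
            shorter : ∀ {l} → l < length (A ++ u ∷ B ++ u ∷ C) → l ≤ n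
            shorter l< = ≤-pred (≤-trans l< L≤1+n)

    closed-winding-zero : ∀ {x w} → Winds R c x x w → w ≡ 0
    closed-winding-zero {x} {w} (L , p , winds) =
      +-cancelʳ-≡ (flow (flip c) x L) w 0 (trans (sym winds) (closed-path-balanced p))

-- Lifting levels modulo N to the integers

module _ {m : ℕ} {R : Fin m → Fin m → Set}
         (level : Fin m → ℕ) (N : ℕ) (c : Fin m → Fin m → ℕ)
         (step : ∀ {x y} → R x y → ∣ level y + N * c x y - (level x + N * c y x) ∣ ≤ 1) where

  lift-along : ∀ {x L y} → Path R x L y →
    ∣ level y + N * flow c x L - (level x + N * flow (flip c) x L) ∣ ≤ length L
  lift-along {x} [] = ≤-reflexive (∣n-n∣≡0 (level x + N * 0))
  lift-along {x} {y ∷ L} {z} (e ∷ p) = begin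
    ∣ level z + N * (c x y + F) - (level x + N * (c y x + B)) ∣
      ≤⟨ ∣-∣-triangle (level z + N * (c x y + F)) middle _ ⟩
    ∣ level z + N * (c x y + F) - middle ∣ + ∣ middle - (level x + N * (c y x + B)) ∣
      ≡⟨ cong₂ _+_ rest-part first-part ⟩
    ∣ level z + N * F - (level y + N * B) ∣ + ∣ level y + N * c x y - (level x + N * c y x) ∣
      ≤⟨ +-mono-≤ (lift-along p) (step e) ⟩
    length L + 1
      ≡⟨ +-comm (length L) 1 ⟩
    suc (length L) ∎
    where
      open ≤-Reasoning
      F = flow c y L
      B = flow (flip c) y L
      middle = N * c x y + (level y + N * B)
      shift-first : ∀ a n b f → a + n * (b + f) ≡ n * b + (a + n * f)
      shift-first = solve-∀
      shift-last : ∀ a n b f → a + n * (b + f) ≡ n * f + (a + n * b)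
      shift-last = solve-∀
      swap-multiples : ∀ a n b f → n * b + (a + n * f) ≡ n * f + (a + n * b)
      swap-multiples = solve-∀
      rest-part : ∣ level z + N * (c x y + F) - middle ∣ ≡ ∣ level z + N * F - (level y + N * B) ∣
      rest-part = trans (cong ∣_- middle ∣ (shift-first (level z) N (c x y) F))
                        (∣m+n-m+o∣≡∣n-o∣ (N * c x y) _ _)
      first-part : ∣ middle - (level x + N * (c y x + B)) ∣ ≡ ∣ level y + N * c x y - (level x + N * c y x) ∣
      first-part = trans (cong₂ ∣_-_∣ (swap-multiples (level y) N (c x y) B) (shift-last (level x) N (c y x) B))
                         (∣m+n-m+o∣≡∣n-o∣ (N * B) _ _)

∣n-1+n∣≡1 : ∀ n → ∣ n - suc n ∣ ≡ 1
∣n-1+n∣≡1 zero    = refl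
∣n-1+n∣≡1 (suc n) = ∣n-1+n∣≡1 n

close-multiples-equal : ∀ N a f g → ∣ a + N * f - (a + N * g) ∣ < N → f ≡ g
close-multiples-equal N a f g close with ∣ f - g ∣ in f-g
... | zero  = ∣m-n∣≡0⇒m≡n f-g
... | suc d = ⊥-elim (<⇒≱ close (begin
  N                            ≤⟨ m≤m*n N (suc d) ⟩
  N * suc d                    ≡⟨ cong (N *_) f-g ⟨
  N * ∣ f - g ∣                ≡⟨ *-distribˡ-∣-∣ N f g ⟩
  ∣ N * f - N * g ∣            ≡⟨ ∣m+n-m+o∣≡∣n-o∣ a _ _ ⟨
  ∣ a + N * f - (a + N * g) ∣  ∎))
  where open ≤-Reasoning

winding-determined : ∀ N {a b f g w d} →
  ∣ a + N * f - (b + N * g) ∣ ≤ d → suc d < N → suc b ≡ a + N * w → f ≡ w + g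
winding-determined N {a} {b} {f} {g} {w} {d} near d<N b+1≡a+Nw =
  close-multiples-equal N a f (w + g) (begin-strict
    ∣ a + N * f - (a + N * (w + g)) ∣
      ≤⟨ ∣-∣-triangle (a + N * f) (b + N * g) _ ⟩
    ∣ a + N * f - (b + N * g) ∣ + ∣ b + N * g - (a + N * (w + g)) ∣
      ≡⟨ cong (λ z → ∣ a + N * f - (b + N * g) ∣ + ∣ b + N * g - z ∣) lift-by-one ⟩
    ∣ a + N * f - (b + N * g) ∣ + ∣ b + N * g - suc (b + N * g) ∣
      ≡⟨ cong (∣ a + N * f - (b + N * g) ∣ +_) (∣n-1+n∣≡1 (b + N * g)) ⟩
    ∣ a + N * f - (b + N * g) ∣ + 1
      ≤⟨ +-monoˡ-≤ 1 near ⟩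
    d + 1
      ≡⟨ +-comm d 1 ⟩
    suc d
      <⟨ d<N ⟩
    N ∎)
  where
    open ≤-Reasoning
    lift-by-one : a + N * (w + g) ≡ suc (b + N * g)
    lift-by-one = begin-equality
      a + N * (w + g)   ≡⟨ cong (a +_) (*-distribˡ-+ N w g) ⟩
      a + (N * w + N * g) ≡⟨ +-assoc a _ _ ⟨
      a + N * w + N * g ≡⟨ cong (_+ N * g) b+1≡a+Nw ⟨
      suc b + N * g     ∎

-- Forests given by parent pointers

module _ {m : ℕ} {R : Fin m → Fin m → Set} where

  Walk-++ : ∀ {x y z a b} → Walk R x y a → Walk R y z b → Walk R x z (a + b)
  Walk-++ []      w′ = w′
  Walk-++ (e ∷ w) w′ = e ∷ Walk-++ w w′

  Walk-∷ʳ : ∀ {x y z a} → Walk R x y a → R y z → Walk R x z (suc a)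
  Walk-∷ʳ []       e = e ∷ []
  Walk-∷ʳ (e′ ∷ w) e = e′ ∷ Walk-∷ʳ w e

  Walk-reverse : (∀ {x y} → R x y → R y x) → ∀ {x y a} → Walk R x y a → Walk R y x a
  Walk-reverse R-sym []      = []
  Walk-reverse R-sym (e ∷ w) = Walk-∷ʳ (Walk-reverse R-sym w) (R-sym e)

-- Parent x y means that y is the parent of x.
module ParentForest {m : ℕ} (Parent : Fin m → Fin m → Set)
         (parent-unique : ∀ {x y z} → Parent x y → Parent x z → y ≡ z)
         (rank : Fin m → ℕ) (rank-parent : ∀ {x y} → Parent x y → rank x ≡ suc (rank y)) where

  Link : Fin m → Fin m → Set
  Link x y = Parent x y ⊎ Parent y x

  rank-parent-< : ∀ {x y} → Parent x y → rank y < rank x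
  rank-parent-< p = ≤-reflexive (sym (rank-parent p))

  NonBacktracking : List (Fin m) → Set
  NonBacktracking (a ∷ b ∷ c ∷ xs) = a ≢ c × NonBacktracking (b ∷ c ∷ xs)
  NonBacktracking _                = ⊤

  Ascending : List (Fin m) → Set
  Ascending (a ∷ b ∷ xs) = Parent a b × Ascending (b ∷ xs)
  Ascending _            = ⊤

  EndsDescending : Fin m → List (Fin m) → Set
  EndsDescending a []           = ⊥
  EndsDescending a (b ∷ [])     = Parent b a
  EndsDescending a (b ∷ c ∷ xs) = EndsDescending b (c ∷ xs)

  ascending-rank : ∀ a b xs → Ascending (a ∷ b ∷ xs) → rank (target b xs) < rank a
  ascending-rank a b []       (p , _)   = rank-parent-< p
  ascending-rank a b (c ∷ xs) (p , asc) = <-trans (ascending-rank b c xs asc) (rank-parent-< p)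

  -- Once a walk without backtracking steps down to a child, it can never step up again.
  descent-persists : ∀ a b xs → Chain Link (a ∷ b ∷ xs) → NonBacktracking (a ∷ b ∷ xs) →
                     Parent b a → rank a < rank (target b xs)
  descent-persists a b []       _                    _          p = rank-parent-< p
  descent-persists a b (c ∷ xs) (_ , inj₁ q , _)     (a≢c , _)  p = ⊥-elim (a≢c (parent-unique p q))
  descent-persists a b (c ∷ xs) (_ , inj₂ q , chain) (_ , nb)   p =
    <-trans (rank-parent-< p) (descent-persists b c xs (inj₂ q , chain) nb q)

  ascending-or-ends-descending : ∀ a b xs → Chain Link (a ∷ b ∷ xs) → NonBacktracking (a ∷ b ∷ xs) →
                                 Ascending (a ∷ b ∷ xs) ⊎ EndsDescending a (b ∷ xs)
  ascending-or-ends-descending a b []       (inj₁ p , _) _ = inj₁ (p , tt)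
  ascending-or-ends-descending a b []       (inj₂ p , _) _ = inj₂ p
  ascending-or-ends-descending a b (c ∷ xs) (e , chain) (a≢c , nb)
    with ascending-or-ends-descending b c xs chain nb
  ... | inj₂ ends = inj₂ ends
  ... | inj₁ asc with e
  ...   | inj₁ p = inj₁ (p , asc)
  ...   | inj₂ p = ⊥-elim (a≢c (parent-unique p (proj₁ asc)))

  ends-descending-∷ʳ : ∀ a b xs x → EndsDescending a ((b ∷ xs) ++ x ∷ []) →
                       ∃[ q ] (q ∈ b ∷ xs × Parent x q)
  ends-descending-∷ʳ a b []       x p    = b , here refl , p
  ends-descending-∷ʳ a b (c ∷ xs) x ends with ends-descending-∷ʳ b c xs x ends
  ... | q , q∈ , p = q , there q∈ , p

  cycle-nonbacktracking : ∀ x a b xs → Unique (x ∷ a ∷ b ∷ xs) →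
                          NonBacktracking (x ∷ a ∷ b ∷ xs ++ x ∷ [])
  cycle-nonbacktracking x a b xs (x∉ ∷ uq) = All-lookup x∉ (there (here refl)) , closing a b xs uq x∉
    where
      closing : ∀ a b xs → Unique (a ∷ b ∷ xs) → All (x ≢_) (a ∷ b ∷ xs) →
                NonBacktracking (a ∷ b ∷ xs ++ x ∷ [])
      closing a b []       _                    (x≢a ∷ _) = (λ a≡x → x≢a (sym a≡x)) , tt
      closing a b (c ∷ xs) ((_ ∷ a≢c ∷ _) ∷ uq) (_ ∷ x∉) = a≢c , closing b c xs uq x∉

  -- Round a cycle the rank can neither only fall nor rise from the first step on; otherwise the
  -- first and the last step both join x to its parent, which is then visited twice.
  acyclic : ¬ HasCycle Link
  acyclic (x , []          , () , _)
  acyclic (x , _ ∷ []      , s≤s () , _)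
  acyclic (x , a ∷ b ∷ xs , _ , uq@(_ ∷ a∉ ∷ _) , chain)
    with ascending-or-ends-descending x a (b ∷ xs ++ x ∷ []) chain (cycle-nonbacktracking x a b xs uq)
  ... | inj₁ asc = <-irrefl back-at-x (ascending-rank x a (b ∷ xs ++ x ∷ []) asc)
    where back-at-x = cong rank (target-∷ʳ a (b ∷ xs) x)
  ... | inj₂ ends with ends-descending-∷ʳ a b xs x ends | proj₁ chain
  ...   | q , q∈ , x↑q | inj₁ x↑a = All-lookup a∉ q∈ (parent-unique x↑a x↑q)
  ...   | _ | inj₂ a↑x = <-irrefl (sym back-at-x)
          (descent-persists x a (b ∷ xs ++ x ∷ []) chain (cycle-nonbacktracking x a b xs uq) a↑x)
    where back-at-x = cong rank (target-∷ʳ a (b ∷ xs) x)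

  module _ (root : Fin m) (rank-root : rank root ≡ 0)
           (root-or-parent : ∀ x → x ≡ root ⊎ ∃[ y ] Parent x y) where

    walk-to-root : ∀ x → Walk Link x root (rank x)
    walk-to-root x = descend (rank x) x refl
      where
        descend : ∀ r x → rank x ≡ r → Walk Link x root r
        descend r x rank≡r with root-or-parent x
        ... | inj₁ refl = subst (Walk Link root root) (trans (sym rank-root) rank≡r) []
        descend zero    x rank≡0 | inj₂ (y , p) = ⊥-elim (1+n≢0 (trans (sym (rank-parent p)) rank≡0))
        descend (suc r) x rank≡r | inj₂ (y , p) =
          inj₁ p ∷ descend r y (suc-injective (trans (sym (rank-parent p)) rank≡r))

    connected : Connected Link
    connected x y = rank x + rank y , Walk-++ (walk-to-root x) (Walk-reverse swap (walk-to-root y))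

-- The cycle C_ℓ and its generalized inflations

module CycleOrder (k : ℕ) where

  ℓ : ℕ
  ℓ = suc (suc (suc k))

  last : Fin ℓ
  last = fromℕ (suc (suc k))

  next : Fin ℓ → Fin ℓ
  next i = fromℕ< (m%n<n (suc (toℕ i)) ℓ)

  prev : Fin ℓ → Fin ℓ
  prev zero    = last
  prev (suc j) = inject₁ j

  toℕ-next : ∀ i → toℕ (next i) ≡ suc (toℕ i) % ℓ
  toℕ-next i = toℕ-fromℕ< _

  next-adjacent : ∀ i → CycleAdj ℓ i (next i)
  next-adjacent i = inj₁ (sym (toℕ-next i))

  adjacent⇒next : ∀ {i j} → CycleAdj ℓ i j → j ≡ next i ⊎ i ≡ next j
  adjacent⇒next {i} {j} (inj₁ i+1≡j) = inj₁ (toℕ-injective (trans (sym i+1≡j) (sym (toℕ-next i))))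
  adjacent⇒next {i} {j} (inj₂ j+1≡i) = inj₂ (toℕ-injective (trans (sym j+1≡i) (sym (toℕ-next j))))

  next-last : next last ≡ zero
  next-last = toℕ-injective (begin
    toℕ (next last)           ≡⟨ toℕ-next last ⟩
    suc (toℕ last) % ℓ        ≡⟨ cong (λ t → suc t % ℓ) (toℕ-fromℕ (suc (suc k))) ⟩
    ℓ % ℓ                     ≡⟨ n%n≡0 ℓ ⟩
    0                         ∎)
    where open ≡-Reasoning

  next-inject₁ : ∀ j → next (inject₁ j) ≡ suc j
  next-inject₁ j = toℕ-injective (begin
    toℕ (next (inject₁ j))    ≡⟨ toℕ-next (inject₁ j) ⟩
    suc (toℕ (inject₁ j)) % ℓ ≡⟨ cong (λ t → suc t % ℓ) (toℕ-inject₁ j) ⟩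
    suc (toℕ j) % ℓ           ≡⟨ m<n⇒m%n≡m (s≤s (toℕ<n j)) ⟩
    suc (toℕ j)               ∎)
    where open ≡-Reasoning

  next-prev : ∀ j → next (prev j) ≡ j
  next-prev zero    = next-last
  next-prev (suc j) = next-inject₁ j

  prev-next : ∀ i → prev (next i) ≡ i
  prev-next i with view i
  ... | ‵fromℕ     rewrite next-last       = refl
  ... | ‵inject₁ j rewrite next-inject₁ j = refl

  next≢id : ∀ i → next i ≢ i
  next≢id i with view i
  ... | ‵fromℕ     rewrite next-last       = λ ()
  ... | ‵inject₁ j rewrite next-inject₁ j = λ eq → 1+n≢n (trans (cong toℕ eq) (toℕ-inject₁ j))

  prev≢id : ∀ i → prev i ≢ i
  prev≢id i eq = next≢id i (trans (cong next (sym eq)) (next-prev i))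

  -- This is where ℓ ≥ 3 is used.
  next≢prev : ∀ i → next i ≢ prev i
  next≢prev i with view i
  ... | ‵fromℕ     rewrite next-last = λ ()
  ... | ‵inject₁ j rewrite next-inject₁ j = suc≢prev-inject₁ j
    where
      suc≢prev-inject₁ : ∀ (j : Fin (suc (suc k))) → suc j ≢ prev (inject₁ j)
      suc≢prev-inject₁ zero    ()
      suc≢prev-inject₁ (suc j) eq = <-irrefl (sym two-more) (m<n⇒m<1+n (n<1+n (toℕ j)))
        where
          two-more : suc (suc (toℕ j)) ≡ toℕ j
          two-more = trans (cong toℕ eq) (trans (toℕ-inject₁ (inject₁ j)) (toℕ-inject₁ j))

module Inflation (k : ℕ) (H : Graph) (simple : IsSimple H)
                 (inflation : IsGeneralizedInflation (Cycle (suc (suc (suc k)))) H) where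

  open CycleOrder k
  open IsGeneralizedInflation inflation

  V : Set
  V = Fin (n H)

  Adj-sym : ∀ {x y} → Adj H x y → Adj H y x
  Adj-sym = IsSimple.sym simple

  port : ∀ i → ∃[ x ] ∃[ y ] (φ x ≡ i × φ y ≡ next i × Adj H x y)
  port i = edge-exists i (next i) (next-adjacent i)

  src tgt : Fin ℓ → V
  src i = proj₁ (port i)
  tgt i = proj₁ (proj₂ (port i))

  φ-src : ∀ i → φ (src i) ≡ i
  φ-src i = proj₁ (proj₂ (proj₂ (port i)))

  φ-tgt : ∀ i → φ (tgt i) ≡ next i
  φ-tgt i = proj₁ (proj₂ (proj₂ (proj₂ (port i))))

  hub : Fin ℓ → V
  hub j = tgt (prev j)

  φ-hub : ∀ j → φ (hub j) ≡ j
  φ-hub j = trans (φ-tgt (prev j)) (next-prev j)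

  hub-next : ∀ i → hub (next i) ≡ tgt i
  hub-next i = cong tgt (prev-next i)

  port-edge : ∀ i → Adj H (src i) (hub (next i))
  port-edge i = subst (Adj H (src i)) (sym (hub-next i)) (proj₂ (proj₂ (proj₂ (proj₂ (port i)))))

  -- Otherwise hub j would have the two outside neighbours src (prev j) and hub (next j).
  src≢hub : ∀ j → src j ≢ hub j
  src≢hub j src≡hub = next≢prev j (begin
    next j                  ≡⟨ φ-hub (next j) ⟨
    φ (hub (next j))        ≡⟨ cong φ same-neighbour ⟨
    φ (src (prev j))        ≡⟨ φ-src (prev j) ⟩
    prev j                  ∎)
    where
      open ≡-Reasoning
      same-neighbour : src (prev j) ≡ hub (next j)
      same-neighbour = matching (hub j) (src (prev j)) (hub (next j))
        (Adj-sym (subst (Adj H (src (prev j))) (cong hub (next-prev j)) (port-edge (prev j))))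
        (subst (λ z → Adj H z (hub (next j))) src≡hub (port-edge j))
        (λ eq → prev≢id j (trans (sym (φ-src (prev j))) (trans (sym eq) (φ-hub j))))
        (λ eq → next≢id j (trans (sym (φ-hub (next j))) (trans (sym eq) (φ-hub j))))

  data EdgeKind (x y : V) : Set where
    inside  : φ x ≡ φ y → EdgeKind x y
    outward : ∀ i → x ≡ src i → y ≡ hub (next i) → EdgeKind x y
    inward  : ∀ i → x ≡ hub (next i) → y ≡ src i → EdgeKind x y

  port-unique : ∀ {x y} → Adj H x y → φ y ≡ next (φ x) → x ≡ src (φ x) × y ≡ hub (next (φ x))
  port-unique {x} {y} a φy≡next = edge-unique x y (src (φ x)) (hub (next (φ x))) a (port-edge (φ x))
    (λ eq → next≢id (φ x) (trans (sym φy≡next) (sym eq)))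
    (sym (φ-src (φ x))) (trans φy≡next (sym (φ-hub (next (φ x)))))

  classify : ∀ {x y} → Adj H x y → EdgeKind x y
  classify {x} {y} a with φ x ≟ φ y
  ... | yes same = inside same
  ... | no differ with adjacent⇒next (inter-edge x y a differ)
  ...   | inj₁ forward  with x≡src , y≡hub ← port-unique a forward = outward (φ x) x≡src y≡hub
  ...   | inj₂ backward with y≡src , x≡hub ← port-unique (Adj-sym a) backward = inward (φ y) x≡hub y≡src

  off-hub : V → ℕ
  off-hub x with x ≟ hub (φ x)
  ... | yes _ = 0
  ... | no _  = 1

  level : V → ℕ
  level x = 2 * toℕ (φ x) + off-hub x

  off-hub-≤1 : ∀ x → off-hub x ≤ 1
  off-hub-≤1 x with x ≟ hub (φ x)
  ... | yes _ = z≤n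
  ... | no _  = ≤-refl

  level-hub : ∀ j → level (hub j) ≡ 2 * toℕ j
  level-hub j with hub j ≟ hub (φ (hub j))
  ... | yes _        = trans (+-identityʳ _) (cong (λ i → 2 * toℕ i) (φ-hub j))
  ... | no not-hub   = ⊥-elim (not-hub (cong hub (sym (φ-hub j))))

  level-off-hub : ∀ {x} → x ≢ hub (φ x) → level x ≡ suc (2 * toℕ (φ x))
  level-off-hub {x} not-hub with x ≟ hub (φ x)
  ... | yes is-hub = ⊥-elim (not-hub is-hub)
  ... | no _       = +-comm _ 1

  level-src : ∀ j → level (src j) ≡ suc (2 * toℕ j)
  level-src j = trans (level-off-hub (λ eq → src≢hub j (trans eq (cong hub (φ-src j)))))
                      (cong (λ i → suc (2 * toℕ i)) (φ-src j))

  -- A tree (2ℓ - 1)-spanner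

  hub-injective : ∀ {i j} → hub i ≡ hub j → i ≡ j
  hub-injective {i} {j} eq = trans (sym (φ-hub i)) (trans (cong φ eq) (φ-hub j))

  data Parent (x y : V) : Set where
    to-hub  : x ≢ hub (φ x) → y ≡ hub (φ x) → Parent x y
    to-prev : ∀ j → x ≡ hub (suc j) → y ≡ src (inject₁ j) → Parent x y

  parent-unique : ∀ {x y z} → Parent x y → Parent x z → y ≡ z
  parent-unique (to-hub _ y≡)      (to-hub _ z≡)        = trans y≡ (sym z≡)
  parent-unique (to-hub not-hub _) (to-prev j refl _)   = ⊥-elim (not-hub (cong hub (sym (φ-hub (suc j)))))
  parent-unique (to-prev j refl _) (to-hub not-hub _)   = ⊥-elim (not-hub (cong hub (sym (φ-hub (suc j)))))
  parent-unique (to-prev j x≡ y≡)  (to-prev j′ x≡′ z≡) =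
    trans y≡ (trans (cong (λ i → src (inject₁ i)) (Fin.suc-injective (hub-injective (trans (sym x≡) x≡′))))
                    (sym z≡))

  level-parent : ∀ {x y} → Parent x y → level x ≡ suc (level y)
  level-parent {x} (to-hub not-hub refl) = trans (level-off-hub not-hub) (cong suc (sym (level-hub (φ x))))
  level-parent (to-prev j refl refl) = begin
    level (hub (suc j))                  ≡⟨ level-hub (suc j) ⟩
    2 * suc (toℕ j)                      ≡⟨ *-suc 2 (toℕ j) ⟩
    suc (suc (2 * toℕ j))                ≡⟨ cong (λ t → suc (suc (2 * t))) (toℕ-inject₁ j) ⟨
    suc (suc (2 * toℕ (inject₁ j)))      ≡⟨ cong suc (level-src (inject₁ j)) ⟨
    suc (level (src (inject₁ j)))        ∎
    where open ≡-Reasoning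

  parent-edge : ∀ {x y} → Parent x y → Adj H x y
  parent-edge {x} {y} (to-hub not-hub y≡hub) =
    clique x y (λ x≡y → not-hub (trans x≡y y≡hub)) (sym (trans (cong φ y≡hub) (φ-hub (φ x))))
  parent-edge (to-prev j refl refl) =
    Adj-sym (subst (λ i → Adj H (src (inject₁ j)) (hub i)) (next-inject₁ j) (port-edge (inject₁ j)))

  root : V
  root = hub zero

  root-or-parent : ∀ x → x ≡ root ⊎ ∃[ y ] Parent x y
  root-or-parent x with x ≟ hub (φ x) | φ x in φx
  ... | no not-hub | _     = inj₂ (_ , to-hub not-hub refl)
  ... | yes is-hub | zero  = inj₁ (trans is-hub (cong hub φx))
  ... | yes is-hub | suc j = inj₂ (_ , to-prev j (trans is-hub (cong hub φx)) refl)

  open ParentForest Parent parent-unique level level-parent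

  link-spanning-tree : IsSpanningTree H Link
  link-spanning-tree = record
    { subgraph  = λ { (inj₁ p) → parent-edge p ; (inj₂ p) → Adj-sym (parent-edge p) }
    ; symmetric = swap
    ; connected = connected root (level-hub zero) root-or-parent
    ; acyclic   = acyclic
    }

  level-src-last : level (src last) ≡ 2 * ℓ ∸ 1
  level-src-last = trans (level-src last)
                         (trans (cong (λ t → suc (2 * t)) (toℕ-fromℕ (suc (suc k)))) (normal-form k))
    where
      normal-form : ∀ a → 1 + 2 * (2 + a) ≡ 2 + (a + (3 + (a + 0)))
      normal-form = solve-∀

  DistLe-reverse : ∀ {x y t} → DistLe Link x y t → DistLe Link y x t
  DistLe-reverse (d , d≤t , walk) = d , d≤t , Walk-reverse swap walk

  port-stretch : ∀ i → DistLe Link (src i) (hub (next i)) (2 * ℓ ∸ 1)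
  port-stretch i with view i
  ... | ‵fromℕ     = subst (λ i′ → DistLe Link (src last) (hub i′) (2 * ℓ ∸ 1)) (sym next-last)
    (level (src last) , ≤-reflexive level-src-last ,
     walk-to-root root (level-hub zero) root-or-parent (src last))
  ... | ‵inject₁ j = subst (λ i′ → DistLe Link (src (inject₁ j)) (hub i′) (2 * ℓ ∸ 1)) (sym (next-inject₁ j))
    (1 , s≤s z≤n , inj₂ (to-prev j refl refl) ∷ [])

  inside-stretch : ∀ {x y} → Adj H x y → φ x ≡ φ y → DistLe Link x y (2 * ℓ ∸ 1)
  inside-stretch {x} {y} a same with x ≟ hub (φ x) | y ≟ hub (φ y)
  ... | yes x-hub | _ = 1 , s≤s z≤n , inj₂ (to-hub y-not-hub (trans x-hub (cong hub same))) ∷ []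
    where
      y-not-hub : y ≢ hub (φ y)
      y-not-hub y-hub = IsSimple.irrefl simple
        (subst (Adj H x) (trans y-hub (trans (cong hub (sym same)) (sym x-hub))) a)
  ... | no x-not-hub | yes y-hub =
    1 , s≤s z≤n , inj₁ (to-hub x-not-hub (trans y-hub (cong hub (sym same)))) ∷ []
  ... | no x-not-hub | no y-not-hub =
    2 , s≤s (s≤s z≤n) , inj₁ (to-hub x-not-hub refl) ∷ inj₂ (to-hub y-not-hub (cong hub same)) ∷ []

  link-stretch : ∀ x y → Adj H x y → DistLe Link x y (2 * ℓ ∸ 1)
  link-stretch x y a with classify a
  ... | inside same        = inside-stretch a same
  ... | outward i refl refl = port-stretch i
  ... | inward i refl refl  = DistLe-reverse (port-stretch i)

  -- No tree spanner of smaller stretch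

  wraps : Fin ℓ → Fin ℓ → ℕ
  wraps i zero with i ≟ last
  ... | yes _ = 1
  ... | no _  = 0
  wraps i (suc _) = 0

  wraps-same : ∀ j → wraps j j ≡ 0
  wraps-same zero    = refl
  wraps-same (suc j) = refl

  wraps-last : wraps last zero ≡ 1
  wraps-last with last ≟ last
  ... | yes _       = refl
  ... | no last≢last = ⊥-elim (last≢last refl)

  wraps-back : ∀ i → wraps (next i) i ≡ 0
  wraps-back i with view i
  ... | ‵fromℕ     = cong (λ j → wraps j last) next-last
  ... | ‵inject₁ j = trans (cong (λ i′ → wraps i′ (inject₁ j)) (next-inject₁ j)) (back-step j)
    where
      back-step : ∀ (j : Fin (suc (suc k))) → wraps (suc j) (inject₁ j) ≡ 0
      back-step zero    = refl
      back-step (suc j) = refl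

  crossing : V → V → ℕ
  crossing x y = wraps (φ x) (φ y)

  drop-zero-multiple : ∀ a {w} → w ≡ 0 → a + 2 * ℓ * w ≡ a
  drop-zero-multiple a refl = trans (cong (a +_) (*-zeroʳ (2 * ℓ))) (+-identityʳ a)

  port-level : ∀ i → suc (level (src i)) ≡ level (hub (next i)) + 2 * ℓ * wraps i (next i)
  port-level i with view i
  ... | ‵fromℕ = begin
    suc (level (src last))
      ≡⟨ cong suc level-src-last ⟩
    2 * ℓ
      ≡⟨ *-identityʳ (2 * ℓ) ⟨
    2 * ℓ * 1
      ≡⟨ cong₂ (λ a w → a + 2 * ℓ * w) (level-hub zero) wraps-last ⟨
    level (hub zero) + 2 * ℓ * wraps last zero
      ≡⟨ cong (λ j → level (hub j) + 2 * ℓ * wraps last j) next-last ⟨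
    level (hub (next last)) + 2 * ℓ * wraps last (next last) ∎
    where open ≡-Reasoning
  ... | ‵inject₁ j = begin
    suc (level (src (inject₁ j)))
      ≡⟨ cong suc (level-src (inject₁ j)) ⟩
    2 + 2 * toℕ (inject₁ j)
      ≡⟨ cong (λ t → 2 + 2 * t) (toℕ-inject₁ j) ⟩
    2 + 2 * toℕ j
      ≡⟨ *-suc 2 (toℕ j) ⟨
    2 * toℕ (suc j)
      ≡⟨ level-hub (suc j) ⟨
    level (hub (suc j))
      ≡⟨ drop-zero-multiple (level (hub (suc j))) refl ⟨
    level (hub (suc j)) + 2 * ℓ * wraps (inject₁ j) (suc j)
      ≡⟨ cong (λ i′ → level (hub i′) + 2 * ℓ * wraps (inject₁ j) i′) (next-inject₁ j) ⟨
    level (hub (next (inject₁ j))) + 2 * ℓ * wraps (inject₁ j) (next (inject₁ j)) ∎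
    where open ≡-Reasoning

  crossing-port : ∀ i → crossing (src i) (hub (next i)) ≡ wraps i (next i)
  crossing-port i = cong₂ wraps (φ-src i) (φ-hub (next i))

  crossing-port-back : ∀ i → crossing (hub (next i)) (src i) ≡ 0
  crossing-port-back i = trans (cong₂ wraps (φ-hub (next i)) (φ-src i)) (wraps-back i)

  port-lift : ∀ i → ∣ level (hub (next i)) + 2 * ℓ * crossing (src i) (hub (next i))
                      - (level (src i) + 2 * ℓ * crossing (hub (next i)) (src i)) ∣ ≤ 1
  port-lift i = ≤-reflexive (begin
    ∣ level (hub (next i)) + 2 * ℓ * crossing (src i) (hub (next i))
      - (level (src i) + 2 * ℓ * crossing (hub (next i)) (src i)) ∣
      ≡⟨ cong₂ ∣_-_∣ (trans (cong (λ w → level (hub (next i)) + 2 * ℓ * w) (crossing-port i))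
                            (sym (port-level i)))
                     (drop-zero-multiple (level (src i)) (crossing-port-back i)) ⟩
    ∣ suc (level (src i)) - level (src i) ∣
      ≡⟨ ∣-∣-comm (suc (level (src i))) (level (src i)) ⟩
    ∣ level (src i) - suc (level (src i)) ∣
      ≡⟨ ∣n-1+n∣≡1 (level (src i)) ⟩
    1 ∎)
    where open ≡-Reasoning

  inside-lift : ∀ {x y} → φ x ≡ φ y →
                ∣ level y + 2 * ℓ * crossing x y - (level x + 2 * ℓ * crossing y x) ∣ ≤ 1
  inside-lift {x} {y} same = begin
    ∣ level y + 2 * ℓ * crossing x y - (level x + 2 * ℓ * crossing y x) ∣
      ≡⟨ cong₂ ∣_-_∣ (drop-zero-multiple (level y) (no-crossing same))
                     (drop-zero-multiple (level x) (no-crossing (sym same))) ⟩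
    ∣ 2 * toℕ (φ y) + off-hub y - (2 * toℕ (φ x) + off-hub x) ∣
      ≡⟨ cong (λ i → ∣ 2 * toℕ (φ y) + off-hub y - (2 * toℕ i + off-hub x) ∣) same ⟩
    ∣ 2 * toℕ (φ y) + off-hub y - (2 * toℕ (φ y) + off-hub x) ∣
      ≡⟨ ∣m+n-m+o∣≡∣n-o∣ (2 * toℕ (φ y)) _ _ ⟩
    ∣ off-hub y - off-hub x ∣
      ≤⟨ ∣m-n∣≤m⊔n (off-hub y) (off-hub x) ⟩
    off-hub y ⊔ off-hub x
      ≤⟨ ⊔-lub (off-hub-≤1 y) (off-hub-≤1 x) ⟩
    1 ∎
    where
      open ≤-Reasoning
      no-crossing : ∀ {u v} → φ u ≡ φ v → crossing u v ≡ 0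
      no-crossing {u} {v} eq = trans (cong (λ i → wraps i (φ v)) eq) (wraps-same (φ v))

  edge-lift : ∀ {x y} → Adj H x y →
              ∣ level y + 2 * ℓ * crossing x y - (level x + 2 * ℓ * crossing y x) ∣ ≤ 1
  edge-lift a with classify a
  ... | inside same         = inside-lift same
  ... | outward i refl refl = port-lift i
  ... | inward i refl refl  =
    subst (_≤ 1) (∣-∣-comm (level (hub (next i)) + 2 * ℓ * crossing (src i) (hub (next i))) _) (port-lift i)

  module _ {T : V → V → Set} (tree : IsSpanningTree H T) {t : ℕ}
           (spanner : ∀ x y → Adj H x y → DistLe T x y t) (short : 2 + t ≤ 2 * ℓ) where

    edge-winds : ∀ {x y w} → Adj H x y → suc (level x) ≡ level y + 2 * ℓ * w → Winds T crossing x y w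
    edge-winds {x} {y} a climbs with spanner x y a
    ... | d , d≤t , walk with Walk⇒Path walk
    ...   | L , refl , path = L , path ,
      winding-determined (2 * ℓ) {level y} {level x} {flow crossing x L} {flow (flip crossing) x L}
                         (lift-along level (2 * ℓ) crossing tree-edge-lift path)
                         (≤-trans (s≤s (s≤s d≤t)) short) climbs
      where
        tree-edge-lift : ∀ {u v} → T u v →
                         ∣ level v + 2 * ℓ * crossing u v - (level u + 2 * ℓ * crossing v u) ∣ ≤ 1
        tree-edge-lift e = edge-lift (IsSpanningTree.subgraph tree e)

    hub-to-src : ∀ j → Winds T crossing (hub j) (src j) 0
    hub-to-src j = edge-winds
      (clique (hub j) (src j) (λ eq → src≢hub j (sym eq)) (trans (φ-hub j) (sym (φ-src j))))
      (trans (cong suc (level-hub j)) (sym (trans (drop-zero-multiple (level (src j)) refl) (level-src j))))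

    port-winds : ∀ i → Winds T crossing (src i) (hub (next i)) (wraps i (next i))
    port-winds i = edge-winds (port-edge i) (port-level i)

    root-to-src : ∀ j → Winds T crossing root (src j) 0
    root-to-src = <-weakInduction (λ j → Winds T crossing root (src j) 0) (hub-to-src zero) extend
      where
        extend : ∀ j → Winds T crossing root (src (inject₁ j)) 0 → Winds T crossing root (src (suc j)) 0
        extend j w = Winds-++ w (Winds-++ next-port (hub-to-src (suc j)))
          where
            next-port : Winds T crossing (src (inject₁ j)) (hub (suc j)) 0
            next-port = subst (λ i → Winds T crossing (src (inject₁ j)) (hub i) (wraps (inject₁ j) i))
                         (next-inject₁ j) (port-winds (inject₁ j))

    last-to-root : Winds T crossing (src last) root 1
    last-to-root = subst (Winds T crossing (src last) root) wraps-last
      (subst (λ i → Winds T crossing (src last) (hub i) (wraps last i)) next-last (port-winds last))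

    winds-around : ⊥
    winds-around = 1+n≢0 (closed-winding-zero (IsSpanningTree.acyclic tree) crossing
                                              (Winds-++ (root-to-src last) last-to-root))

  stretch-index : StretchIndexIs H (2 * ℓ ∸ 1)
  stretch-index = (Link , link-spanning-tree , link-stretch) ,
    λ t T (tree , spanner) → ≮⇒≥ (λ t<2ℓ-1 → winds-around tree spanner (s≤s t<2ℓ-1))

corollary1 : (ℓ : ℕ) → .{{_ : NonZero ℓ}} → 3 ≤ ℓ →
    (H : Graph) → IsSimple H → IsGeneralizedInflation (Cycle ℓ) H →
    StretchIndexIs H (2 * ℓ ∸ 1)
corollary1 (suc (suc (suc k))) _ H simple inflation = Inflation.stretch-index k H simple inflation
corollary1 (suc (suc zero)) (s≤s (s≤s ()))
corollary1 (suc zero) (s≤s ())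
corollary1 zero ()
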